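{- Let $\langle M,\oplus,\otimes\rangle$ be a topological model of arithmetic. Then there is a continuous injection $M\times M\to M$. Indeed, there is a continuous bijection from $M\times M$ onto the set of even numbers $\{x\oplus x\mid x\in M\}$ of $M$ (with the subspace topology).
   Context: A topological model of arithmetic is a topological space $M$ with binary operations $\oplus,\otimes:M\times M\to M$, continuous with respect to the product topology, such that $\langle M,\oplus,\otimes\rangle$ is a model of arithmetic; here "arithmetic" means Peano arithmetic ${\rm PA}$. $M\times M$ carries the product topology. -}

module Defs where

open import Data.Nat using (ℕ; zero; suc)
open import Data.Product using (Σ; _×_; _,_; proj₁; proj₂)
open import Data.Empty using (⊥)
open import Data.Unit using (⊤)
open import Relation.Binary.PropositionalEquality using (_≡_; _≢_)
open import Relation.Nullary using (Dec)

-- Classical metatheory (the paper works in ZFC)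

ExcludedMiddle : Set₁
ExcludedMiddle = (A : Set) → Dec A

record Topology (M : Set) : Set₁ where
  field
    Open       : (M → Set) → Set
    open-whole : Open (λ _ → ⊤)
    open-union : (I : Set) (U : I → M → Set) → (∀ i → Open (U i)) →
                 Open (λ x → Σ I (λ i → U i x))
    open-inter : (U V : M → Set) → Open U → Open V → Open (λ x → U x × V x)

open Topology public

ProdOpen : {M : Set} → Topology M → (M × M → Set) → Set₁
ProdOpen {M} τ W =
  (p : M × M) → W p →
  Σ (M → Set) λ A → Σ (M → Set) λ B →
    Open τ A × Open τ B × A (proj₁ p) × B (proj₂ p) ×
    ((q : M × M) → A (proj₁ q) → B (proj₂ q) → W q)

SubOpen : {M : Set} → Topology M → (S : M → Set) → (Σ M S → Set) → Set₁
SubOpen {M} τ S V =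
  Σ (M → Set) λ U → Open τ U × ((e : Σ M S) → (V e → U (proj₁ e)) × (U (proj₁ e) → V e))

ContinuousOp : {M : Set} → Topology M → (M → M → M) → Set₁
ContinuousOp {M} τ _∙_ = (U : M → Set) → Open τ U → ProdOpen τ (λ p → U (proj₁ p ∙ proj₂ p))

ContinuousProd→ : {M : Set} → Topology M → (M × M → M) → Set₁
ContinuousProd→ {M} τ g = (U : M → Set) → Open τ U → ProdOpen τ (λ p → U (g p))

ContinuousProd→Sub : {M : Set} → (τ : Topology M) → (S : M → Set) → (M × M → Σ M S) → Set₁
ContinuousProd→Sub {M} τ S f = (V : Σ M S → Set) → SubOpen τ S V → ProdOpen τ (λ p → V (f p))

-- First-order language of arithmetic {+, ×} (de Bruijn variables)

infixl 6 _+ₜ_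
infixl 7 _*ₜ_
data Term : Set where
  var   : ℕ → Term
  _+ₜ_  : Term → Term → Term
  _*ₜ_  : Term → Term → Term

infix 4 _≐_
infixr 2 _⇒_
-- A complete set of connectives for classical first-order logic
data Formula : Set where
  _≐_ : Term → Term → Formula
  ⊥f  : Formula
  _⇒_ : Formula → Formula → Formula
  ∀f  : Formula → Formula

Env : Set → Set
Env M = ℕ → M

_∷ₑ_ : {M : Set} → M → Env M → Env M
(x ∷ₑ ρ) zero    = x
(x ∷ₑ ρ) (suc n) = ρ n

module Semantics {M : Set} (_⊕_ _⊗_ : M → M → M) where
  ⟦_⟧t : Term → Env M → M
  ⟦ var n ⟧t ρ    = ρ n
  ⟦ s +ₜ t ⟧t ρ  = ⟦ s ⟧t ρ ⊕ ⟦ t ⟧t ρ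
  ⟦ s *ₜ t ⟧t ρ  = ⟦ s ⟧t ρ ⊗ ⟦ t ⟧t ρ

  ⟦_⟧f : Formula → Env M → Set
  ⟦ s ≐ t ⟧f ρ = ⟦ s ⟧t ρ ≡ ⟦ t ⟧t ρ
  ⟦ ⊥f ⟧f ρ    = ⊥
  ⟦ φ ⇒ ψ ⟧f ρ = ⟦ φ ⟧f ρ → ⟦ ψ ⟧f ρ
  ⟦ ∀f φ ⟧f ρ  = (x : M) → ⟦ φ ⟧f (x ∷ₑ ρ)

-- Models of Peano arithmetic: ⟨M, ⊕, ⊗⟩ with (definable) 0 and 1 satisfying
-- the axioms of PA; the induction schema is given semantically: for every
-- formula φ(x, params) and every assignment ρ of the parameters (variable 0
-- is the induction variable), the universal closure of the instance holds.

record PAModel (M : Set) (_⊕_ _⊗_ : M → M → M) : Set where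
  open Semantics _⊕_ _⊗_
  field
    z o        : M
    succ≢zero  : (x : M) → (x ⊕ o) ≢ z
    succ-inj   : (x y : M) → x ⊕ o ≡ y ⊕ o → x ≡ y
    add-zero   : (x : M) → x ⊕ z ≡ x
    add-succ   : (x y : M) → x ⊕ (y ⊕ o) ≡ (x ⊕ y) ⊕ o
    mul-zero   : (x : M) → x ⊗ z ≡ z
    mul-succ   : (x y : M) → x ⊗ (y ⊕ o) ≡ (x ⊗ y) ⊕ x
    induction  : (φ : Formula) (ρ : Env M) →
                 ⟦ φ ⟧f (z ∷ₑ ρ) →
                 ((x : M) → ⟦ φ ⟧f (x ∷ₑ ρ) → ⟦ φ ⟧f ((x ⊕ o) ∷ₑ ρ)) →
                 (x : M) → ⟦ φ ⟧f (x ∷ₑ ρ)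

IsEven : {M : Set} → (M → M → M) → M → Set
IsEven {M} _⊕_ e = Σ M λ x → x ⊕ x ≡ e

module Submission where

-- Let pair (x , y) = (x + y)(x + y + 1) + 2x, twice the Cantor pairing
-- function.  Being a polynomial, pair is continuous on M × M in every
-- topological model: term functions are built from projections and constants
-- by the continuous operations.  Arithmetic inside the model shows that pair
-- takes only even values, hits every even number and is injective, which
-- gives both the continuous injection M × M → M and the continuous bijection
-- onto the even numbers.
--
-- The schema
-- only applies to first-order definable predicates, so every induction goes
-- through `definable-induction`, which asks for a formula defining the
-- predicate; existential and conjunctive claims are encoded by double
-- negation and decoded with excluded middle.  The key device for surjectivity
-- and injectivity is the successor `next` of a pair in the diagonal
-- enumeration of M × M: pair (next p) = pair p + 2, and every pair other than
-- (0 , 0) is `next` of some pair.  Induction on n then shows that 2n has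
-- exactly one preimage under pair.

open import Defs
open import Data.Nat using (zero; suc)
open import Data.Product using (Σ; _×_; _,_; proj₁; proj₂)
open import Data.Sum using (_⊎_; inj₁; inj₂)
open import Data.Empty using (⊥-elim)
open import Data.Unit using (⊤; tt)
open import Relation.Nullary using (¬_; yes; no)
open import Relation.Binary.PropositionalEquality
open import Algebra.Bundles using (CommutativeMonoid)
import Algebra.Solver.CommutativeMonoid as CommutativeMonoidSolver

-- The formula language has only ⊥, ⇒ and ∀, so
-- existential and conjunctive claims are expressed by double negation; these
-- lemmas decode them back into witnesses and pairs.
module Classical (lem : ExcludedMiddle) where

  stable : {A : Set} → ¬ ¬ A → A
  stable {A} ¬¬a with lem A
  ... | yes a = a
  ... | no ¬a = ⊥-elim (¬¬a ¬a)

  ¬∀¬⇒∃ : {A : Set} {B : A → Set} → ¬ ((x : A) → ¬ B x) → Σ A B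
  ¬∀¬⇒∃ h = stable λ ¬∃ → h λ x b → ¬∃ (x , b)

  ¬⇒¬⇒× : {A B : Set} → ¬ (A → ¬ B) → A × B
  ¬⇒¬⇒× h = stable (λ ¬a → h λ a _ → ¬a a) , stable (λ ¬b → h λ _ b → ¬b b)

infix  3 ¬f_ ∃f_
infixr 3 _∧f_

¬f_ : Formula → Formula
¬f φ = φ ⇒ ⊥f

∃f_ : Formula → Formula
∃f φ = ¬f (∀f (¬f φ))

_∧f_ : Formula → Formula → Formula
φ ∧f ψ = ¬f (φ ⇒ ¬f ψ)

-- The oblong number t ⊗ t ⊕ t and the pairing polynomial as terms, so that
-- they can occur in induction formulas and in the continuity argument.
oblongₜ : Term → Term
oblongₜ t = t *ₜ t +ₜ t

pairₜ : Term → Term → Term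
pairₜ a b = oblongₜ (a +ₜ b) +ₜ (a +ₜ a)

module ProductContinuity {M : Set} (τ : Topology M) where

  Whole : M → Set
  Whole _ = ⊤

  proj₁-continuous : ContinuousProd→ τ proj₁
  proj₁-continuous U U-open p u =
    U , Whole , U-open , open-whole τ , u , tt , λ _ a _ → a

  proj₂-continuous : ContinuousProd→ τ proj₂
  proj₂-continuous U U-open p u =
    Whole , U , open-whole τ , U-open , tt , u , λ _ _ b → b

  const-continuous : (c : M) → ContinuousProd→ τ (λ _ → c)
  const-continuous c U U-open p u =
    Whole , Whole , open-whole τ , open-whole τ , tt , tt , λ _ _ _ → u

  -- Combining two continuous maps by a continuous operation: pull U back
  -- along the operation to a box A × B, pull A and B back along the two maps,
  -- and intersect the resulting boxes.
  op-continuous : (_∙_ : M → M → M) → ContinuousOp τ _∙_ →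
                  {g h : M × M → M} → ContinuousProd→ τ g → ContinuousProd→ τ h →
                  ContinuousProd→ τ (λ p → g p ∙ h p)
  op-continuous _∙_ ∙-continuous {g} {h} g-continuous h-continuous U U-open p u =
    let (A , B , A-open , B-open , a , b , AB⊆U) = ∙-continuous U U-open (g p , h p) u
        (A₁ , B₁ , A₁-open , B₁-open , a₁ , b₁ , g⁻¹A) = g-continuous A A-open p a
        (A₂ , B₂ , A₂-open , B₂-open , a₂ , b₂ , h⁻¹B) = h-continuous B B-open p b
    in (λ m → A₁ m × A₂ m) , (λ m → B₁ m × B₂ m)
       , open-inter τ A₁ A₂ A₁-open A₂-open , open-inter τ B₁ B₂ B₁-open B₂-open
       , (a₁ , a₂) , (b₁ , b₂)
       , λ q (qa₁ , qa₂) (qb₁ , qb₂) →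
           AB⊆U (g q , h q) (g⁻¹A q qa₁ qb₁) (h⁻¹B q qa₂ qb₂)

  -- A map into a subspace is continuous as soon as its composite with the
  -- inclusion is: a subspace-open set is the trace of an open set of M.
  corestriction-continuous : (S : M → Set) (f : M × M → Σ M S) →
                             ContinuousProd→ τ (λ p → proj₁ (f p)) →
                             ContinuousProd→Sub τ S f
  corestriction-continuous S f f-continuous V (U , U-open , V≡U∩S) p v =
    let (A , B , A-open , B-open , a , b , AB⊆) =
          f-continuous U U-open p (proj₁ (V≡U∩S (f p)) v)
    in A , B , A-open , B-open , a , b , λ q qa qb → proj₂ (V≡U∩S (f q)) (AB⊆ q qa qb)

module TermContinuity {M : Set} (τ : Topology M) {_⊕_ _⊗_ : M → M → M}
                      (⊕-continuous : ContinuousOp τ _⊕_)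
                      (⊗-continuous : ContinuousOp τ _⊗_) (ρ : Env M) where
  open Semantics _⊕_ _⊗_
  open ProductContinuity τ

  term-continuous : (t : Term) →
                    ContinuousProd→ τ (λ p → ⟦ t ⟧t (proj₁ p ∷ₑ (proj₂ p ∷ₑ ρ)))
  term-continuous (var zero)          = proj₁-continuous
  term-continuous (var (suc zero))    = proj₂-continuous
  term-continuous (var (suc (suc n))) = const-continuous (ρ n)
  term-continuous (s +ₜ t) =
    op-continuous _⊕_ ⊕-continuous (term-continuous s) (term-continuous t)
  term-continuous (s *ₜ t) =
    op-continuous _⊗_ ⊗-continuous (term-continuous s) (term-continuous t)

module PAArithmetic (lem : ExcludedMiddle) {M : Set} {_⊕_ _⊗_ : M → M → M}
                    (P : PAModel M _⊕_ _⊗_) where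
  open PAModel P public
  open Semantics _⊕_ _⊗_
  open Classical lem public

  S : M → M
  S x = x ⊕ o

  Defines : Formula → Env M → (M → Set) → Set
  Defines φ ρ Q = (x : M) → (⟦ φ ⟧f (x ∷ₑ ρ) → Q x) × (Q x → ⟦ φ ⟧f (x ∷ₑ ρ))

  definable-induction : (φ : Formula) (ρ : Env M) {Q : M → Set} → Defines φ ρ Q →
                        Q z → ((x : M) → Q x → Q (S x)) → (x : M) → Q x
  definable-induction φ ρ defines base step x =
    proj₁ (defines x)
      (induction φ ρ (proj₂ (defines z) base)
         (λ y φy → proj₂ (defines (S y)) (step y (proj₁ (defines y) φy))) x)

  -- Addition is a commutative monoid.  Here, and for *-sucˡ below, the
  -- formula denotes exactly the claim, so the schema is applied directly.
  +-identityˡ : (x : M) → z ⊕ x ≡ x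
  +-identityˡ = induction (var 1 +ₜ var 0 ≐ var 0) (λ _ → z) (add-zero z)
    (λ x ih → trans (add-succ z x) (cong S ih))

  +-sucˡ : (y x : M) → S y ⊕ x ≡ S (y ⊕ x)
  +-sucˡ y = induction ((var 1 +ₜ var 2) +ₜ var 0 ≐ (var 1 +ₜ var 0) +ₜ var 2)
    (y ∷ₑ (o ∷ₑ λ _ → o))
    (trans (add-zero (S y)) (cong S (sym (add-zero y))))
    (λ x ih → trans (add-succ (S y) x) (trans (cong S ih) (cong S (sym (add-succ y x)))))

  +-comm : (x y : M) → x ⊕ y ≡ y ⊕ x
  +-comm x = induction (var 1 +ₜ var 0 ≐ var 0 +ₜ var 1) (λ _ → x)
    (trans (add-zero x) (sym (+-identityˡ x)))
    (λ y ih → trans (add-succ x y) (trans (cong S ih) (sym (+-sucˡ y x))))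

  +-assoc : (a b c : M) → (a ⊕ b) ⊕ c ≡ a ⊕ (b ⊕ c)
  +-assoc a b = induction ((var 1 +ₜ var 2) +ₜ var 0 ≐ var 1 +ₜ (var 2 +ₜ var 0))
    (a ∷ₑ λ _ → b)
    (trans (add-zero (a ⊕ b)) (cong (a ⊕_) (sym (add-zero b))))
    (λ c ih → trans (add-succ (a ⊕ b) c) (trans (cong S ih)
       (trans (sym (add-succ a (b ⊕ c))) (cong (a ⊕_) (sym (add-succ b c))))))

  +-commutativeMonoid : CommutativeMonoid _ _
  +-commutativeMonoid = record
    { Carrier = M ; _≈_ = _≡_ ; _∙_ = _⊕_ ; ε = z
    ; isCommutativeMonoid = record
      { isMonoid = record
        { isSemigroup = record
          { isMagma = record { isEquivalence = isEquivalence ; ∙-cong = cong₂ _⊕_ }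
          ; assoc = +-assoc }
        ; identity = +-identityˡ , add-zero }
      ; comm = +-comm } }

  open CommutativeMonoidSolver +-commutativeMonoid public
    using (solve; _⊜_) renaming (_⊕_ to _⊞_)

  -- Every element is zero or a successor.  Defined by the formula
  -- "if x is no successor then x = 0", with parameters 0 and 1.
  zero-or-succ : (x : M) → x ≡ z ⊎ Σ M (λ y → x ≡ S y)
  zero-or-succ = definable-induction
    ((∀f (¬f (var 1 ≐ var 0 +ₜ var 3))) ⇒ var 0 ≐ var 1) (z ∷ₑ (o ∷ₑ λ _ → z))
    (λ x → decode x , encode x)
    (inj₁ refl) (λ x _ → inj₂ (x , refl))
    where
    decode : (x : M) → (((y : M) → ¬ x ≡ S y) → x ≡ z) → x ≡ z ⊎ Σ M (λ y → x ≡ S y)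
    decode x h with lem (Σ M (λ y → x ≡ S y))
    ... | yes succ = inj₂ succ
    ... | no ¬succ = inj₁ (h λ y e → ¬succ (y , e))
    encode : (x : M) → x ≡ z ⊎ Σ M (λ y → x ≡ S y) → ((y : M) → ¬ x ≡ S y) → x ≡ z
    encode x (inj₁ x≡0)       _   = x≡0
    encode x (inj₂ (y , x≡Sy)) ¬Sy = ⊥-elim (¬Sy y x≡Sy)

  +-zeroʳ-conical : (a b : M) → a ⊕ b ≡ z → b ≡ z
  +-zeroʳ-conical a b a+b≡0 with zero-or-succ b
  ... | inj₁ b≡0        = b≡0
  ... | inj₂ (b' , b≡Sb') =
    ⊥-elim (succ≢zero (a ⊕ b') (trans (sym (add-succ a b')) (trans (cong (a ⊕_) (sym b≡Sb')) a+b≡0)))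

  S-injective₂ : (a b : M) → S (S a) ≡ S (S b) → a ≡ b
  S-injective₂ a b e = succ-inj a b (succ-inj (S a) (S b) e)

  *-sucˡ : (y x : M) → S y ⊗ x ≡ (y ⊗ x) ⊕ x
  *-sucˡ y = induction ((var 1 +ₜ var 2) *ₜ var 0 ≐ (var 1 *ₜ var 0) +ₜ var 0)
    (y ∷ₑ (o ∷ₑ λ _ → o))
    (trans (mul-zero (S y)) (sym (trans (add-zero (y ⊗ z)) (mul-zero y))))
    (λ x ih → begin
       S y ⊗ S x                   ≡⟨ mul-succ (S y) x ⟩
       (S y ⊗ x) ⊕ S y             ≡⟨ cong (_⊕ S y) ih ⟩
       ((y ⊗ x) ⊕ x) ⊕ (y ⊕ o)     ≡⟨ interchange (y ⊗ x) x y o ⟩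
       ((y ⊗ x) ⊕ y) ⊕ (x ⊕ o)     ≡⟨ cong (_⊕ S x) (sym (mul-succ y x)) ⟩
       (y ⊗ S x) ⊕ S x             ∎)
    where
    open ≡-Reasoning
    interchange : (a b c d : M) → (a ⊕ b) ⊕ (c ⊕ d) ≡ (a ⊕ c) ⊕ (b ⊕ d)
    interchange = solve 4 (λ a b c d → (a ⊞ b) ⊞ (c ⊞ d) ⊜ (a ⊞ c) ⊞ (b ⊞ d)) refl

  double-suc : (n : M) → S n ⊕ S n ≡ S (S (n ⊕ n))
  double-suc n = solve 2 (λ n e → (n ⊞ e) ⊞ (n ⊞ e) ⊜ ((n ⊞ n) ⊞ e) ⊞ e) refl n o

module Pairing (lem : ExcludedMiddle) {M : Set} {_⊕_ _⊗_ : M → M → M}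
               (P : PAModel M _⊕_ _⊗_) where
  open PAArithmetic lem P
  open Semantics _⊕_ _⊗_
  open ≡-Reasoning

  oblong : M → M
  oblong s = (s ⊗ s) ⊕ s

  -- Definitionally the value of the term pairₜ (var 0) (var 1).
  pair : M × M → M
  pair (x , y) = oblong (x ⊕ y) ⊕ (x ⊕ x)

  oblong-zero : oblong z ≡ z
  oblong-zero = trans (add-zero (z ⊗ z)) (mul-zero z)

  oblong-suc : (s : M) → oblong (S s) ≡ S (S (oblong s ⊕ (s ⊕ s)))
  oblong-suc s = begin
    (S s ⊗ S s) ⊕ S s              ≡⟨ cong (_⊕ S s) (mul-succ (S s) s) ⟩
    ((S s ⊗ s) ⊕ S s) ⊕ S s        ≡⟨ cong (λ t → (t ⊕ S s) ⊕ S s) (*-sucˡ s s) ⟩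
    (((s ⊗ s) ⊕ s) ⊕ S s) ⊕ S s    ≡⟨ collect (s ⊗ s) s o ⟩
    S (S (oblong s ⊕ (s ⊕ s)))     ∎
    where
    collect : (q s e : M) → ((q ⊕ s) ⊕ (s ⊕ e)) ⊕ (s ⊕ e) ≡ (((q ⊕ s) ⊕ (s ⊕ s)) ⊕ e) ⊕ e
    collect = solve 3 (λ q s e →
      ((q ⊞ s) ⊞ (s ⊞ e)) ⊞ (s ⊞ e) ⊜ (((q ⊞ s) ⊞ (s ⊞ s)) ⊞ e) ⊞ e) refl

  pair-zero : pair (z , z) ≡ z
  pair-zero = begin
    oblong (z ⊕ z) ⊕ (z ⊕ z)   ≡⟨ cong₂ (λ s d → oblong s ⊕ d) (add-zero z) (add-zero z) ⟩
    oblong z ⊕ z               ≡⟨ add-zero (oblong z) ⟩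
    oblong z                   ≡⟨ oblong-zero ⟩
    z                          ∎

  -- Moving one step along a diagonal x ⊕ y = const towards larger x adds 2.
  pair-suc-left : (x y : M) → pair (S x , y) ≡ S (S (pair (x , S y)))
  pair-suc-left x y = begin
    oblong (S x ⊕ y) ⊕ (S x ⊕ S x)    ≡⟨ cong (λ s → oblong s ⊕ (S x ⊕ S x)) (shift x y o) ⟩
    oblong (x ⊕ S y) ⊕ (S x ⊕ S x)    ≡⟨ pull-out (oblong (x ⊕ S y)) x o ⟩
    S (S (pair (x , S y)))            ∎
    where
    shift : (x y e : M) → (x ⊕ e) ⊕ y ≡ x ⊕ (y ⊕ e)
    shift = solve 3 (λ x y e → (x ⊞ e) ⊞ y ⊜ x ⊞ (y ⊞ e)) refl
    pull-out : (q x e : M) → q ⊕ ((x ⊕ e) ⊕ (x ⊕ e)) ≡ ((q ⊕ (x ⊕ x)) ⊕ e) ⊕ e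
    pull-out = solve 3 (λ q x e → q ⊞ ((x ⊞ e) ⊞ (x ⊞ e)) ⊜ ((q ⊞ (x ⊞ x)) ⊞ e) ⊞ e) refl

  -- From the end (x , 0) of one diagonal to the start (0 , x + 1) of the next also adds 2.
  pair-zero-suc : (x : M) → pair (z , S x) ≡ S (S (pair (x , z)))
  pair-zero-suc x = begin
    oblong (z ⊕ S x) ⊕ (z ⊕ z)    ≡⟨ cong₂ (λ s d → oblong s ⊕ d) (+-identityˡ (S x)) (add-zero z) ⟩
    oblong (S x) ⊕ z              ≡⟨ add-zero (oblong (S x)) ⟩
    oblong (S x)                  ≡⟨ oblong-suc x ⟩
    S (S (oblong x ⊕ (x ⊕ x)))    ≡⟨ cong (λ s → S (S (oblong s ⊕ (x ⊕ x)))) (sym (add-zero x)) ⟩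
    S (S (pair (x , z)))          ∎

  -- Only (0 , 0) is mapped to 0, since all summands of pair must vanish.
  pair-zero⇒ : (p : M × M) → pair p ≡ z → p ≡ (z , z)
  pair-zero⇒ (x , y) pair≡0 = cong₂ _,_ x≡0 y≡0
    where
    x≡0 : x ≡ z
    x≡0 = +-zeroʳ-conical x x (+-zeroʳ-conical (oblong (x ⊕ y)) (x ⊕ x) pair≡0)
    oblong≡0 : oblong (x ⊕ y) ≡ z
    oblong≡0 = +-zeroʳ-conical (x ⊕ x) (oblong (x ⊕ y)) (trans (+-comm (x ⊕ x) _) pair≡0)
    y≡0 : y ≡ z
    y≡0 = +-zeroʳ-conical x y (+-zeroʳ-conical ((x ⊕ y) ⊗ (x ⊕ y)) (x ⊕ y) oblong≡0)

  oblong-even : (s : M) → Σ M (λ m → m ⊕ m ≡ oblong s)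
  oblong-even = definable-induction evenₜ (λ _ → z) (λ s → ¬∀¬⇒∃ , encode s)
    (z , trans (add-zero z) (sym oblong-zero))
    (λ s (m , m+m≡) → m ⊕ S s , (begin
      (m ⊕ S s) ⊕ (m ⊕ S s)         ≡⟨ regroup m s o ⟩
      S (S ((m ⊕ m) ⊕ (s ⊕ s)))     ≡⟨ cong (λ t → S (S (t ⊕ (s ⊕ s)))) m+m≡ ⟩
      S (S (oblong s ⊕ (s ⊕ s)))    ≡⟨ sym (oblong-suc s) ⟩
      oblong (S s)                  ∎))
    where
    evenₜ : Formula
    evenₜ = ∃f (var 0 +ₜ var 0 ≐ oblongₜ (var 1))
    encode : (s : M) → Σ M (λ m → m ⊕ m ≡ oblong s) → ⟦ evenₜ ⟧f (s ∷ₑ λ _ → z)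
    encode s (m , m+m≡) ¬even = ¬even m m+m≡
    regroup : (m s e : M) → (m ⊕ (s ⊕ e)) ⊕ (m ⊕ (s ⊕ e)) ≡ (((m ⊕ m) ⊕ (s ⊕ s)) ⊕ e) ⊕ e
    regroup = solve 3 (λ m s e →
      (m ⊞ (s ⊞ e)) ⊞ (m ⊞ (s ⊞ e)) ⊜ (((m ⊞ m) ⊞ (s ⊞ s)) ⊞ e) ⊞ e) refl

  pair-even : (p : M × M) → IsEven _⊕_ (pair p)
  pair-even (x , y) =
    let (m , m+m≡) = oblong-even (x ⊕ y)
    in m ⊕ x , trans (interchange m x) (cong (_⊕ (x ⊕ x)) m+m≡)
    where
    interchange : (m x : M) → (m ⊕ x) ⊕ (m ⊕ x) ≡ (m ⊕ m) ⊕ (x ⊕ x)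
    interchange = solve 2 (λ m x → (m ⊞ x) ⊞ (m ⊞ x) ⊜ (m ⊞ m) ⊞ (x ⊞ x)) refl

  -- The successor of a pair in the diagonal enumeration
  -- (0 , 0), (0 , 1), (1 , 0), (0 , 2), (1 , 1), (2 , 0), (0 , 3), ...
  next : M × M → M × M
  next (x , y) with zero-or-succ y
  ... | inj₁ _        = z , S x
  ... | inj₂ (y' , _) = S x , y'

  next-zero-right : (x : M) → next (x , z) ≡ (z , S x)
  next-zero-right x with zero-or-succ z
  ... | inj₁ _            = refl
  ... | inj₂ (y , 0≡Sy)   = ⊥-elim (succ≢zero y (sym 0≡Sy))

  next-suc-right : (x y : M) → next (x , S y) ≡ (S x , y)
  next-suc-right x y with zero-or-succ (S y)
  ... | inj₁ Sy≡0         = ⊥-elim (succ≢zero y Sy≡0)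
  ... | inj₂ (y' , Sy≡Sy') = cong (S x ,_) (sym (succ-inj y y' Sy≡Sy'))

  -- pair enumerates the even numbers in the order given by `next`.
  pair-next : (p : M × M) → pair (next p) ≡ S (S (pair p))
  pair-next (x , y) with zero-or-succ y
  ... | inj₁ y≡0 =
    trans (pair-zero-suc x) (cong (λ y → S (S (pair (x , y)))) (sym y≡0))
  ... | inj₂ (y' , y≡Sy') =
    trans (pair-suc-left x y') (cong (λ y → S (S (pair (x , y)))) (sym y≡Sy'))

  next-onto : (p : M × M) → p ≢ (z , z) → Σ (M × M) (λ p' → next p' ≡ p)
  next-onto (x , y) p≢0 with zero-or-succ x | zero-or-succ y
  ... | inj₂ (x' , x≡Sx') | _ =
    (x' , S y) , trans (next-suc-right x' y) (cong (_, y) (sym x≡Sx'))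
  ... | inj₁ x≡0 | inj₂ (y' , y≡Sy') =
    (y' , z) , trans (next-zero-right y') (cong₂ _,_ (sym x≡0) (sym y≡Sy'))
  ... | inj₁ x≡0 | inj₁ y≡0 = ⊥-elim (p≢0 (cong₂ _,_ x≡0 y≡0))

  pair-predecessor : (p : M × M) (m : M) → pair p ≡ S (S m) →
                     Σ (M × M) (λ p' → next p' ≡ p × pair p' ≡ m)
  pair-predecessor p m pair≡ =
    let (p' , next-p'≡p) = next-onto p p≢0
    in p' , next-p'≡p ,
       S-injective₂ (pair p') m (trans (sym (pair-next p')) (trans (cong pair next-p'≡p) pair≡))
    where
    p≢0 : p ≢ (z , z)
    p≢0 p≡0 = succ≢zero (S m) (trans (sym pair≡) (trans (cong pair p≡0) pair-zero))

  pair-surjective : (n : M) → Σ (M × M) (λ p → pair p ≡ n ⊕ n)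
  pair-surjective = definable-induction hitₜ (λ _ → z) (λ n → decode n , encode n)
    ((z , z) , trans pair-zero (sym (add-zero z)))
    (λ n (p , pair≡) →
      next p , trans (pair-next p) (trans (cong (λ t → S (S t)) pair≡) (sym (double-suc n))))
    where
    hitₜ : Formula
    hitₜ = ∃f (∃f (pairₜ (var 1) (var 0) ≐ var 2 +ₜ var 2))
    decode : (n : M) → ⟦ hitₜ ⟧f (n ∷ₑ λ _ → z) → Σ (M × M) (λ p → pair p ≡ n ⊕ n)
    decode n hit =
      let (x , hit-x) = ¬∀¬⇒∃ hit
          (y , pair≡) = ¬∀¬⇒∃ hit-x
      in (x , y) , pair≡
    encode : (n : M) → Σ (M × M) (λ p → pair p ≡ n ⊕ n) → ⟦ hitₜ ⟧f (n ∷ₑ λ _ → z)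
    encode n ((x , y) , pair≡) ¬hit = ¬hit x λ ¬hit-x → ¬hit-x y pair≡

  -- 2n has at most one preimage under pair, by induction on n: the preimages of
  -- 2(n + 1) are successors of preimages of 2n, and `next` is a function.
  UniquePreimage : M → Set
  UniquePreimage n = (p q : M × M) → pair p ≡ n ⊕ n → pair q ≡ n ⊕ n → p ≡ q

  unique-preimage : (n : M) → UniquePreimage n
  unique-preimage = definable-induction uniqueₜ (λ _ → z) (λ n → decode n , encode n)
    (λ p q pair-p pair-q → trans (pair-zero⇒ p (trans pair-p (add-zero z)))
                                 (sym (pair-zero⇒ q (trans pair-q (add-zero z)))))
    step
    where
    uniqueₜ : Formula
    uniqueₜ = ∀f (∀f (∀f (∀f (pairₜ (var 3) (var 2) ≐ var 4 +ₜ var 4 ⇒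
                               pairₜ (var 1) (var 0) ≐ var 4 +ₜ var 4 ⇒
                               (var 3 ≐ var 1 ∧f var 2 ≐ var 0)))))
    decode : (n : M) → ⟦ uniqueₜ ⟧f (n ∷ₑ λ _ → z) → UniquePreimage n
    decode n unique (x , y) (x' , y') pair-p pair-q =
      let (x≡x' , y≡y') = ¬⇒¬⇒× (unique x y x' y' pair-p pair-q) in cong₂ _,_ x≡x' y≡y'
    encode : (n : M) → UniquePreimage n → ⟦ uniqueₜ ⟧f (n ∷ₑ λ _ → z)
    encode n unique x y x' y' pair-p pair-q ¬both =
      let p≡q = unique (x , y) (x' , y') pair-p pair-q in ¬both (cong proj₁ p≡q) (cong proj₂ p≡q)
    step : (n : M) → UniquePreimage n → UniquePreimage (S n)
    step n unique p q pair-p pair-q =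
      let (p' , next-p'≡p , pair-p') = pair-predecessor p (n ⊕ n) (trans pair-p (double-suc n))
          (q' , next-q'≡q , pair-q') = pair-predecessor q (n ⊕ n) (trans pair-q (double-suc n))
      in begin
        p        ≡⟨ sym next-p'≡p ⟩
        next p'  ≡⟨ cong next (unique p' q' pair-p' pair-q') ⟩
        next q'  ≡⟨ next-q'≡q ⟩
        q        ∎

  pair-injective : (p q : M × M) → pair p ≡ pair q → p ≡ q
  pair-injective p q pair≡ =
    let (n , n+n≡) = pair-even p
    in unique-preimage n p q (sym n+n≡) (trans (sym pair≡) (sym n+n≡))

mainTheorem12 : ExcludedMiddle →
    (M : Set) (τ : Topology M) (_⊕_ _⊗_ : M → M → M) →
    ContinuousOp τ _⊕_ → ContinuousOp τ _⊗_ → PAModel M _⊕_ _⊗_ →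
    (Σ (M × M → M) λ g →
    ContinuousProd→ τ g × ((p q : M × M) → g p ≡ g q → p ≡ q))
    ×
    (Σ (M × M → Σ M (IsEven _⊕_)) λ f →
    ContinuousProd→Sub τ (IsEven _⊕_) f
    × ((p q : M × M) → proj₁ (f p) ≡ proj₁ (f q) → p ≡ q)
    × ((e : Σ M (IsEven _⊕_)) → Σ (M × M) λ p → proj₁ (f p) ≡ proj₁ e))
mainTheorem12 lem M τ _⊕_ _⊗_ ⊕-continuous ⊗-continuous P =
    (pair , pair-continuous , pair-injective)
  , (toEven , corestriction-continuous (IsEven _⊕_) toEven pair-continuous
     , pair-injective , toEven-onto)
  where
  open PAModel P using (z)
  open Pairing lem P
  open ProductContinuity τ
  open TermContinuity τ ⊕-continuous ⊗-continuous (λ _ → z)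

  pair-continuous : ContinuousProd→ τ pair
  pair-continuous = term-continuous (pairₜ (var 0) (var 1))

  toEven : M × M → Σ M (IsEven _⊕_)
  toEven p = pair p , pair-even p

  toEven-onto : (e : Σ M (IsEven _⊕_)) → Σ (M × M) (λ p → pair p ≡ proj₁ e)
  toEven-onto (e , n , n+n≡e) =
    let (p , pair≡) = pair-surjective n in p , trans pair≡ n+n≡e
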